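{- Let $G=(V,E)$ be a $2$-vertex strongly biconnected directed graph with $n=|V|$, and let $O\subseteq E$ be an optimal solution of the minimum $2$-vertex strongly biconnected spanning subgraph problem on $G$, i.e. an edge set of minimum size such that $(V,O)$ is $2$-vertex strongly biconnected. Then $|O|\ge 2n$.
   Context: A directed graph is strongly biconnected if it is strongly connected and its underlying undirected graph is biconnected. A strongly biconnected directed graph $G=(V,E)$ is $2$-vertex strongly biconnected if $|V|\ge 3$ and for every vertex $w\in V$ the induced subgraph on $V\setminus\{w\}$ is strongly biconnected. -}

module Defs where

open import Data.Nat using (ℕ; zero; suc; _+_; _≤_)
open import Data.Bool using (Bool; true; false; _∨_; _∧_; not)
open import Data.Fin using (Fin; _≟_)
open import Data.List using (List; map; allFin)
open import Data.Nat.ListAction using (sum)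
open import Data.Product using (_×_)
open import Relation.Binary.PropositionalEquality using (_≡_)
open import Relation.Nullary.Decidable using (⌊_⌋)

-- A (simple) directed graph on vertex set Fin n, given by its adjacency
-- relation: E u v ≡ true iff the edge (u , v) is present.
Digraph : ℕ → Set
Digraph n = Fin n → Fin n → Bool

VSet : ℕ → Set
VSet n = Fin n → Bool

_∖_ : ∀ {n} → VSet n → Fin n → VSet n
(S ∖ w) v = S v ∧ not ⌊ v ≟ w ⌋

full : ∀ {n} → VSet n
full _ = true

Loopless : ∀ {n} → Digraph n → Set
Loopless {n} E = (v : Fin n) → E v v ≡ false

undirected : ∀ {n} → Digraph n → Digraph n
undirected E u v = E u v ∨ E v u

-- directed walks from u to w all of whose vertices lie in S,
-- i.e. walks in the subgraph induced by S
data Walk {n : ℕ} (E : Digraph n) (S : VSet n) : Fin n → Fin n → Set where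
  here  : ∀ {u} → S u ≡ true → Walk E S u u
  there : ∀ {u v w} → S u ≡ true → E u v ≡ true → Walk E S v w → Walk E S u w

StronglyConnected : ∀ {n} → Digraph n → VSet n → Set
StronglyConnected {n} E S =
  (u v : Fin n) → S u ≡ true → S v ≡ true → Walk E S u v

Connected : ∀ {n} → Digraph n → VSet n → Set
Connected E S = StronglyConnected (undirected E) S

Biconnected : ∀ {n} → Digraph n → VSet n → Set
Biconnected {n} E S =
  Connected E S × ((w : Fin n) → S w ≡ true → Connected E (S ∖ w))

StronglyBiconnected : ∀ {n} → Digraph n → VSet n → Set
StronglyBiconnected E S = StronglyConnected E S × Biconnected E S

TwoVertexStronglyBiconnected : ∀ {n} → Digraph n → Set
TwoVertexStronglyBiconnected {n} E =
  (3 ≤ n) × StronglyBiconnected E full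
          × ((w : Fin n) → StronglyBiconnected E (full ∖ w))

_⊆E_ : ∀ {n} → Digraph n → Digraph n → Set
_⊆E_ {n} O E = (u v : Fin n) → O u v ≡ true → E u v ≡ true

bit : Bool → ℕ
bit true  = 1
bit false = 0

edgeCount : ∀ {n} → Digraph n → ℕ
edgeCount {n} E = sum (map (λ u → sum (map (λ v → bit (E u v)) (allFin n))) (allFin n))

Optimal2VSBSS : ∀ {n} → Digraph n → Digraph n → Set
Optimal2VSBSS {n} E O =
  (O ⊆E E) × TwoVertexStronglyBiconnected O
    × ((O' : Digraph n) → O' ⊆E E → TwoVertexStronglyBiconnected O' →
         edgeCount O ≤ edgeCount O')

module Submission where

-- Every vertex of a 2-vertex strongly biconnected loopless digraph on at
-- least three vertices has out-degree at least 2; summing out-degrees then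
-- gives at least 2n edges.
--
-- Pick a vertex v ≠ u; a walk from u
-- to v in O starts with an edge u → x₁, and x₁ ≠ u since O ⊆ E is loopless.
-- Removing x₁ leaves O strongly connected, so a walk from u to a vertex
-- v' ∉ {u, x₁} inside V ∖ {x₁} starts with an edge u → x₂ with x₂ ≠ x₁.

open import Defs
open import Data.Nat using (ℕ; zero; suc; _≤_; _*_; z≤n; s≤s)
open import Data.Nat.Properties using (≤-trans; +-mono-≤; *-suc; *-zeroʳ; m≤n+m)
open import Data.Bool using (Bool; true; false)
open import Data.Fin using (Fin; _≟_) renaming (zero to fz; suc to fs)
open import Data.List using (map; tabulate; allFin)
open import Data.List.Properties using (map-tabulate)
open import Data.Nat.ListAction using (sum)
open import Data.Product using (Σ-syntax; _×_; _,_; proj₁)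
open import Data.Empty using (⊥-elim)
open import Relation.Nullary using (yes; no)
open import Relation.Binary.PropositionalEquality
  using (_≡_; _≢_; refl; sym; trans; cong; subst)

count : ∀ {n} → (Fin n → Bool) → ℕ
count {n} f = sum (tabulate (λ i → bit (f i)))

-- Sums over allFin n are sums over tabulate, which recurse structurally.
sum-allFin : ∀ {n} (g : Fin n → ℕ) → sum (map g (allFin n)) ≡ sum (tabulate g)
sum-allFin g = cong sum (map-tabulate (λ i → i) g)

count-≥1 : ∀ {n} (f : Fin n → Bool) (a : Fin n) → f a ≡ true → 1 ≤ count f
count-≥1 f fz fa rewrite fa = s≤s z≤n
count-≥1 f (fs a) fa = ≤-trans (count-≥1 (λ i → f (fs i)) a fa) (m≤n+m _ (bit (f fz)))

count-≥2 : ∀ {n} (f : Fin n → Bool) (a b : Fin n) →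
           f a ≡ true → f b ≡ true → a ≢ b → 2 ≤ count f
count-≥2 f fz     fz     fa fb a≢b = ⊥-elim (a≢b refl)
count-≥2 f fz     (fs b) fa fb a≢b rewrite fa = s≤s (count-≥1 (λ i → f (fs i)) b fb)
count-≥2 f (fs a) fz     fa fb a≢b rewrite fb = s≤s (count-≥1 (λ i → f (fs i)) a fa)
count-≥2 f (fs a) (fs b) fa fb a≢b =
  ≤-trans (count-≥2 (λ i → f (fs i)) a b fa fb (λ a≡b → a≢b (cong fs a≡b)))
          (m≤n+m _ (bit (f fz)))

sum-tabulate-≥ : ∀ {n} k (g : Fin n → ℕ) → (∀ i → k ≤ g i) → k * n ≤ sum (tabulate g)
sum-tabulate-≥ {zero}  k g g≥k rewrite *-zeroʳ k = z≤n
sum-tabulate-≥ {suc n} k g g≥k rewrite *-suc k n =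
  +-mono-≤ (g≥k fz) (sum-tabulate-≥ k (λ i → g (fs i)) (λ i → g≥k (fs i)))

outDegree : ∀ {n} → Digraph n → Fin n → ℕ
outDegree {n} O u = sum (map (λ v → bit (O u v)) (allFin n))

edgeCount-≥ : ∀ {n} k (O : Digraph n) → (∀ u → k ≤ outDegree O u) → k * n ≤ edgeCount O
edgeCount-≥ {n} k O deg =
  subst (k * n ≤_) (sym (sum-allFin (outDegree O)))
        (sum-tabulate-≥ k (outDegree O) deg)

outDegree-≥2 : ∀ {n} (O : Digraph n) (u x y : Fin n) →
               O u x ≡ true → O u y ≡ true → x ≢ y → 2 ≤ outDegree O u
outDegree-≥2 O u x y ux uy x≢y =
  subst (2 ≤_) (sym (sum-allFin (λ v → bit (O u v)))) (count-≥2 (O u) x y ux uy x≢y)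

third-vertex : ∀ {n} → 3 ≤ n → (a b : Fin n) → Σ[ v ∈ Fin n ] (v ≢ a × v ≢ b)
third-vertex (s≤s (s≤s (s≤s _))) fz          fz          = fs fz      , (λ ()) , (λ ())
third-vertex (s≤s (s≤s (s≤s _))) fz          (fs fz)     = fs (fs fz) , (λ ()) , (λ ())
third-vertex (s≤s (s≤s (s≤s _))) fz          (fs (fs _)) = fs fz      , (λ ()) , (λ ())
third-vertex (s≤s (s≤s (s≤s _))) (fs fz)     fz          = fs (fs fz) , (λ ()) , (λ ())
third-vertex (s≤s (s≤s (s≤s _))) (fs fz)     (fs fz)     = fz         , (λ ()) , (λ ())
third-vertex (s≤s (s≤s (s≤s _))) (fs fz)     (fs (fs _)) = fz         , (λ ()) , (λ ())
third-vertex (s≤s (s≤s (s≤s _))) (fs (fs _)) fz          = fs fz      , (λ ()) , (λ ())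
third-vertex (s≤s (s≤s (s≤s _))) (fs (fs _)) (fs fz)     = fz         , (λ ()) , (λ ())
third-vertex (s≤s (s≤s (s≤s _))) (fs (fs _)) (fs (fs _)) = fz         , (λ ()) , (λ ())

∖-intro : ∀ {n} {x w : Fin n} → x ≢ w → (full ∖ w) x ≡ true
∖-intro {x = x} {w} x≢w with x ≟ w
... | yes x≡w = ⊥-elim (x≢w x≡w)
... | no  _   = refl

∖-elim : ∀ {n} {x w : Fin n} → (full ∖ w) x ≡ true → x ≢ w
∖-elim {x = x} {w} x∈ with x ≟ w
∖-elim () | yes _
... | no x≢w = x≢w

walk-start : ∀ {n} {E : Digraph n} {S : VSet n} {a b} → Walk E S a b → S a ≡ true
walk-start (here Sa)      = Sa
walk-start (there Sa _ _) = Sa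

out-neighbour : ∀ {n} {E : Digraph n} {S : VSet n} → StronglyConnected E S →
                ∀ {u v} → S u ≡ true → S v ≡ true → u ≢ v →
                Σ[ x ∈ Fin n ] (E u x ≡ true × S x ≡ true)
out-neighbour sc {u} {v} Su Sv u≢v with sc u v Su Sv
... | here _                  = ⊥-elim (u≢v refl)
... | there {v = x} _ ux walk = x , ux , walk-start walk

loopless-⊆ : ∀ {n} {O E : Digraph n} → O ⊆E E → Loopless E → Loopless O
loopless-⊆ {O = O} O⊆E loopless v with O v v in Ovv
... | false = refl
... | true  with trans (sym (O⊆E v v Ovv)) (loopless v)
...   | ()

neighbour-≢ : ∀ {n} {O : Digraph n} → Loopless O → ∀ {u x} → O u x ≡ true → u ≢ x
neighbour-≢ loopless {u} ux refl with trans (sym ux) (loopless u)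
... | ()

two-out-neighbours : ∀ {n} (O : Digraph n) → Loopless O → 3 ≤ n →
  StronglyConnected O full → (∀ w → StronglyConnected O (full ∖ w)) →
  ∀ u → Σ[ x ∈ Fin n ] Σ[ y ∈ Fin n ] (O u x ≡ true × O u y ≡ true × x ≢ y)
two-out-neighbours O loopless three sc sc∖ u
  with third-vertex three u u
... | v , v≢u , _
  with out-neighbour sc {u} {v} refl refl (λ u≡v → v≢u (sym u≡v))
... | x , ux , _
  with third-vertex three u x
... | v' , v'≢u , v'≢x
  with out-neighbour (sc∖ x) {u} {v'} (∖-intro (neighbour-≢ loopless ux))
                     (∖-intro v'≢x) (λ u≡v' → v'≢u (sym u≡v'))
... | y , uy , y∈V∖x = x , y , ux , uy , λ x≡y → ∖-elim y∈V∖x (sym x≡y)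

lemma3 : (n : ℕ) (E O : Digraph n) → Loopless E →
    TwoVertexStronglyBiconnected E → Optimal2VSBSS E O →
    2 * n ≤ edgeCount O
lemma3 n E O loopless _ (O⊆E , (three , (sc , _) , sc∖) , _) =
  edgeCount-≥ 2 O outDegree≥2
  where
  outDegree≥2 : ∀ u → 2 ≤ outDegree O u
  outDegree≥2 u with two-out-neighbours O (loopless-⊆ O⊆E loopless) three sc
                       (λ w → proj₁ (sc∖ w)) u
  ... | x , y , ux , uy , x≢y = outDegree-≥2 O u x y ux uy x≢y
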